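{- For $n\in\mathbb{Z}_{\ge 0}$ let $G_n=\{2^k(2n+1)-1:k\in\mathbb{Z}_{\ge 0}\}$. Let $\mathcal{G}(x,y)$ be the Grundy number of the position $(x,y)$, $x,y\in\mathbb{N}$, of the restricted chocolate bar game described below. Then for every $n\in\mathbb{Z}_{\ge 0}$ and all $x,y\in\mathbb{N}$: $\mathcal{G}(x,y)=n$ if and only if there exist $s,t\in\mathbb{Z}_{\ge 0}$ with $s\oplus t=n$, $x\in G_s$ and $y\in G_t$. In other words, $\{(x,y)\in\mathbb{N}^2:\mathcal{G}(x,y)=n\}=\mathbb{N}^2\cap\bigcup\{G_s\times G_t: s,t\in\mathbb{Z}_{\ge0},\ s\oplus t=n\}$.
   Context: Restricted (impartial) chocolate bar game: a position $(x,y)$ with $x,y\in\mathbb{N}$ is an $x\times y$ rectangular array of squares (height $x$, width $y$). Two players alternate; a move breaks the bar along one horizontal or vertical grid line into two pieces and eats the smaller piece (if both pieces have the same size, either may be eaten); the remaining piece is the new position. Equivalently, from $(x,y)$ one may move to $(x',y)$ with $\lceil x/2\rceil\le x'<x$ or to $(x,y')$ with $\lceil y/2\rceil\le y'<y$. The $1\times1$ bar $(1,1)$ is terminal; a player who cannot move loses. The Grundy number is $\mathcal{G}(p)=\mathrm{mex}\{\mathcal{G}(h): h \text{ reachable from } p \text{ in one move}\}$, where mex is the least non-negative integer not in the set. $s\oplus t$ denotes the Nim-sum (bitwise exclusive or of binary expansions). -}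

module Defs where

open import Data.Nat.Base using (ℕ; zero; suc; _+_; _*_; _∸_; _^_; ⌊_/2⌋; ⌈_/2⌉)
open import Data.Nat.Properties using (_≟_)
open import Data.Bool.Base using (Bool; true; false; if_then_else_; _xor_)
open import Data.List.Base using (List; []; _∷_; map; _++_; length)
open import Data.List.Membership.DecPropositional _≟_ using (_∈?_)
open import Relation.Nullary.Decidable using (does)

lowBit : ℕ → Bool
lowBit zero          = false
lowBit (suc zero)    = true
lowBit (suc (suc n)) = lowBit n

-- xor with fuel; fuel a + b (or more) is enough since a,b halve each step
xorFuel : ℕ → ℕ → ℕ → ℕ
xorFuel zero    a b = 0
xorFuel (suc f) a b =
  (if lowBit a xor lowBit b then 1 else 0) + 2 * xorFuel f ⌊ a /2⌋ ⌊ b /2⌋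

infixl 6 _⊕_
_⊕_ : ℕ → ℕ → ℕ
a ⊕ b = xorFuel (suc (a + b)) a b

-- mex: least natural number not in the list
-- (the answer is ≤ length l, so length l steps of search suffice)

mexAux : ℕ → ℕ → List ℕ → ℕ
mexAux zero    n l = n
mexAux (suc k) n l = if does (n ∈? l) then mexAux k (suc n) l else n

mex : List ℕ → ℕ
mex l = mexAux (length l) 0 l

-- Restricted chocolate bar game.
-- From (x , y) one may move to (x' , y) with ⌈x/2⌉ ≤ x' < x,
-- or to (x , y') with ⌈y/2⌉ ≤ y' < y.

range : ℕ → ℕ → List ℕ
range a b = go (b ∸ a) a
  where
  go : ℕ → ℕ → List ℕ
  go zero    i = []
  go (suc k) i = i ∷ go k (suc i)

-- Grundy number with fuel; every move decreases x + y, so fuel x + y suffices.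
grundyFuel : ℕ → ℕ → ℕ → ℕ
grundyFuel zero    x y = 0
grundyFuel (suc f) x y =
  mex (map (λ x' → grundyFuel f x' y) (range ⌈ x /2⌉ x)
       ++ map (λ y' → grundyFuel f x y') (range ⌈ y /2⌉ y))

-- 𝒢(x , y) : Grundy number of the x × y bar (meaningful for x , y ≥ 1)
𝒢 : ℕ → ℕ → ℕ
𝒢 x y = grundyFuel (suc (x + y)) x y

_∈G_ : ℕ → ℕ → Set
x ∈G n = Σ ℕ λ k → x ≡ 2 ^ k * (2 * n + 1) ∸ 1
  where open import Data.Product.Base using (Σ)
        open import Relation.Binary.PropositionalEquality using (_≡_)

{-# OPTIONS --safe #-}
-- Write x + 1 = 2^k (2s + 1), so that x ∈ G_s.  In terms of N = x + 1 a move is a passage to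
-- some N′ with N′ < N < 2N′.  Such a move always changes s: equal odd parts and N′ < N force
-- 2N′ ≤ N.  Conversely, for every m < s some move reaches odd part 2m + 1: take the largest
-- 2^j (2m + 1) that is at most N.  So each side of the bar behaves like a Nim heap of size s,
-- and the mex computation of the Grundy number is that of Nim: every m < s ⊕ t is the Nim-sum
-- after lowering one heap, while s ⊕ t itself is unreachable because ⊕ is cancellative.
module Submission where

open import Defs
open import Data.Bool.Base using (Bool; true; false; if_then_else_; _xor_)
open import Data.Bool.Properties using (xor-comm; xor-assoc; xor-same; xor-identityʳ)
open import Data.List.Base using (List; []; _∷_; map; _++_; length)
open import Data.List.Membership.Propositional using (_∈_; _∉_)
open import Data.List.Membership.Propositional.Properties
  using (∈-map⁺; ∈-map⁻; ∈-++⁺ˡ; ∈-++⁺ʳ; ∈-++⁻; ∈-∃++)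
open import Data.List.Properties using (length-++)
open import Data.List.Relation.Unary.Any using (here; there)
open import Data.Nat.Base
  using (ℕ; zero; suc; _+_; _*_; _∸_; _^_; ⌊_/2⌋; ⌈_/2⌉; _≤_; _<_; _≥_; z≤n; s≤s)
open import Data.Nat.Induction using (<-rec)
open import Data.Nat.Properties
open import Data.List.Membership.DecPropositional _≟_ using (_∈?_)
open import Data.Product.Base using (Σ; ∃-syntax; _×_; _,_; proj₁; proj₂)
open import Data.Sum.Base using (_⊎_; inj₁; inj₂)
open import Function.Base using (_∘_)
open import Function.Bundles using (_⇔_; mk⇔)
open import Relation.Binary.Definitions using (tri<; tri≈; tri>)
open import Relation.Binary.PropositionalEquality
open import Relation.Nullary using (¬_; yes; no; contradiction)

bit : Bool → ℕ
bit b = if b then 1 else 0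

bit≤1 : ∀ b → bit b ≤ 1
bit≤1 true  = s≤s z≤n
bit≤1 false = z≤n

bit+2*suc : ∀ b n → bit b + 2 * suc n ≡ suc (suc (bit b + 2 * n))
bit+2*suc b n = begin
  bit b + 2 * suc n          ≡⟨ cong (bit b +_) (*-suc 2 n) ⟩
  bit b + suc (suc (2 * n))  ≡⟨ +-suc (bit b) (suc (2 * n)) ⟩
  suc (bit b + suc (2 * n))  ≡⟨ cong suc (+-suc (bit b) (2 * n)) ⟩
  suc (suc (bit b + 2 * n))  ∎
  where open ≡-Reasoning

n≡lowBit+2*⌊n/2⌋ : ∀ n → n ≡ bit (lowBit n) + 2 * ⌊ n /2⌋
n≡lowBit+2*⌊n/2⌋ zero          = refl
n≡lowBit+2*⌊n/2⌋ (suc zero)    = refl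
n≡lowBit+2*⌊n/2⌋ (suc (suc n)) = begin
  suc (suc n)                                    ≡⟨ cong (suc ∘ suc) (n≡lowBit+2*⌊n/2⌋ n) ⟩
  suc (suc (bit (lowBit n) + 2 * ⌊ n /2⌋))       ≡⟨ bit+2*suc (lowBit n) ⌊ n /2⌋ ⟨
  bit (lowBit n) + 2 * suc ⌊ n /2⌋               ∎
  where open ≡-Reasoning

lowBit-bit+2* : ∀ b n → lowBit (bit b + 2 * n) ≡ b
lowBit-bit+2* true  zero    = refl
lowBit-bit+2* false zero    = refl
lowBit-bit+2* b     (suc n) rewrite bit+2*suc b n = lowBit-bit+2* b n

⌊bit+2*n/2⌋≡n : ∀ b n → ⌊ bit b + 2 * n /2⌋ ≡ n
⌊bit+2*n/2⌋≡n true  zero    = refl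
⌊bit+2*n/2⌋≡n false zero    = refl
⌊bit+2*n/2⌋≡n b     (suc n) rewrite bit+2*suc b n = cong suc (⌊bit+2*n/2⌋≡n b n)

bit+2*-injective : ∀ b m c n → bit b + 2 * m ≡ bit c + 2 * n → b ≡ c × m ≡ n
bit+2*-injective b m c n eq =
  trans (sym (lowBit-bit+2* b m)) (trans (cong lowBit eq) (lowBit-bit+2* c n)) ,
  trans (sym (⌊bit+2*n/2⌋≡n b m)) (trans (cong ⌊_/2⌋ eq) (⌊bit+2*n/2⌋≡n c n))

data Bits : ℕ → Set where
  bits : ∀ b n → Bits (bit b + 2 * n)

bitsView : ∀ n → Bits n
bitsView n = subst Bits (sym (n≡lowBit+2*⌊n/2⌋ n)) (bits (lowBit n) ⌊ n /2⌋)

n<2*n : ∀ {n} → 1 ≤ n → n < 2 * n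
n<2*n {suc n} _ = m<m+n (suc n) (s≤s z≤n)

2*⌊n/2⌋≤n : ∀ n → 2 * ⌊ n /2⌋ ≤ n
2*⌊n/2⌋≤n n = subst (2 * ⌊ n /2⌋ ≤_) (sym (n≡lowBit+2*⌊n/2⌋ n)) (m≤n+m _ (bit (lowBit n)))

n≤1+2*⌊n/2⌋ : ∀ n → n ≤ 1 + 2 * ⌊ n /2⌋
n≤1+2*⌊n/2⌋ n =
  subst (_≤ 1 + 2 * ⌊ n /2⌋) (sym (n≡lowBit+2*⌊n/2⌋ n)) (+-monoˡ-≤ _ (bit≤1 (lowBit n)))

2*m≤1+n⇒m≤n : ∀ {m n} → 2 * m ≤ suc n → m ≤ n
2*m≤1+n⇒m≤n {m} {n} le = ≤-pred (*-cancelˡ-< 2 m (suc n) (≤-<-trans le (n<2*n (s≤s z≤n))))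

⌊n/2⌋<m⇒n<2*m : ∀ {m n} → ⌊ n /2⌋ < m → n < 2 * m
⌊n/2⌋<m⇒n<2*m {m} {n} lt =
  ≤-<-trans (n≤1+2*⌊n/2⌋ n) (subst (_≤ 2 * m) (*-suc 2 ⌊ n /2⌋) (*-monoʳ-≤ 2 lt))

n<2*m⇒⌊n/2⌋<m : ∀ {m n} → n < 2 * m → ⌊ n /2⌋ < m
n<2*m⇒⌊n/2⌋<m {m} {n} lt = *-cancelˡ-< 2 ⌊ n /2⌋ m (≤-<-trans (2*⌊n/2⌋≤n n) lt)

⌊m/2⌋+⌊n/2⌋≤f : ∀ m n {f} → m + n ≤ suc f → ⌊ m /2⌋ + ⌊ n /2⌋ ≤ f
⌊m/2⌋+⌊n/2⌋≤f m n le = 2*m≤1+n⇒m≤n (begin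
  2 * (⌊ m /2⌋ + ⌊ n /2⌋)        ≡⟨ *-distribˡ-+ 2 ⌊ m /2⌋ ⌊ n /2⌋ ⟩
  2 * ⌊ m /2⌋ + 2 * ⌊ n /2⌋      ≤⟨ +-mono-≤ (2*⌊n/2⌋≤n m) (2*⌊n/2⌋≤n n) ⟩
  m + n                          ≤⟨ le ⟩
  _                              ∎)
  where open ≤-Reasoning

bit+2*-halves≤ : ∀ b m c n {f} → bit b + 2 * m + (bit c + 2 * n) ≤ suc f → m + n ≤ f
bit+2*-halves≤ b m c n le = subst₂ (λ p q → p + q ≤ _) (⌊bit+2*n/2⌋≡n b m) (⌊bit+2*n/2⌋≡n c n)
  (⌊m/2⌋+⌊n/2⌋≤f (bit b + 2 * m) (bit c + 2 * n) le)

bit+2*-mono-< : ∀ b c {m n} → m < n → bit b + 2 * m < bit c + 2 * n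
bit+2*-mono-< b c {m} {n} m<n = begin-strict
  bit b + 2 * m   ≤⟨ +-monoˡ-≤ (2 * m) (bit≤1 b) ⟩
  1 + 2 * m       <⟨ n<1+n (1 + 2 * m) ⟩
  2 + 2 * m       ≡⟨ *-suc 2 m ⟨
  2 * suc m       ≤⟨ *-monoʳ-≤ 2 m<n ⟩
  2 * n           ≤⟨ m≤n+m (2 * n) (bit c) ⟩
  bit c + 2 * n   ∎
  where open ≤-Reasoning

xorFuel-0-0 : ∀ f → xorFuel f 0 0 ≡ 0
xorFuel-0-0 zero    = refl
xorFuel-0-0 (suc f) = cong (2 *_) (xorFuel-0-0 f)

xorFuel-enough : ∀ f g {a b} → a + b ≤ f → a + b ≤ g → xorFuel f a b ≡ xorFuel g a b
xorFuel-enough zero    g {zero}  {zero}  _ _ = sym (xorFuel-0-0 g)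
xorFuel-enough (suc f) zero {zero} {zero} _ _ = xorFuel-0-0 (suc f)
xorFuel-enough (suc f) (suc g) {a} {b} le le′ =
  cong (λ r → bit (lowBit a xor lowBit b) + 2 * r)
       (xorFuel-enough f g (⌊m/2⌋+⌊n/2⌋≤f a b le) (⌊m/2⌋+⌊n/2⌋≤f a b le′))

⊕-unfold : ∀ a b → a ⊕ b ≡ bit (lowBit a xor lowBit b) + 2 * (⌊ a /2⌋ ⊕ ⌊ b /2⌋)
⊕-unfold a b = cong (λ r → bit (lowBit a xor lowBit b) + 2 * r)
  (xorFuel-enough (a + b) _ (⌊m/2⌋+⌊n/2⌋≤f a b (n≤1+n (a + b))) (n≤1+n _))

⊕-bits : ∀ b m c n → (bit b + 2 * m) ⊕ (bit c + 2 * n) ≡ bit (b xor c) + 2 * (m ⊕ n)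
⊕-bits b m c n = trans (⊕-unfold (bit b + 2 * m) (bit c + 2 * n))
  (cong₂ (λ p q → bit p + 2 * q)
    (cong₂ _xor_ (lowBit-bit+2* b m) (lowBit-bit+2* c n))
    (cong₂ _⊕_ (⌊bit+2*n/2⌋≡n b m) (⌊bit+2*n/2⌋≡n c n)))

xorFuel-comm : ∀ f a b → xorFuel f a b ≡ xorFuel f b a
xorFuel-comm zero    a b = refl
xorFuel-comm (suc f) a b =
  cong₂ (λ p q → bit p + 2 * q) (xor-comm (lowBit a) (lowBit b))
        (xorFuel-comm f ⌊ a /2⌋ ⌊ b /2⌋)

⊕-comm : ∀ a b → a ⊕ b ≡ b ⊕ a
⊕-comm a b =
  trans (xorFuel-comm (suc (a + b)) a b) (cong (λ f → xorFuel (suc f) b a) (+-comm a b))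

xor-xorʳ : ∀ x y → (x xor y) xor y ≡ x
xor-xorʳ x y = trans (xor-assoc x y y) (trans (cong (x xor_) (xor-same y)) (xor-identityʳ x))

xor-xorˡ : ∀ x y → x xor (x xor y) ≡ y
xor-xorˡ x y = trans (sym (xor-assoc x x y)) (cong (_xor y) (xor-same x))

xor-cancelʳ : ∀ {x y} z → x xor z ≡ y xor z → x ≡ y
xor-cancelʳ {x} {y} z eq =
  trans (sym (xor-xorʳ x z)) (trans (cong (_xor z) eq) (xor-xorʳ y z))

⊕-cancelʳ : ∀ a b c → a ⊕ c ≡ b ⊕ c → a ≡ b
⊕-cancelʳ a b c = bounded (a + b) ≤-refl
  where
  bounded : ∀ f {a b c} → a + b ≤ f → a ⊕ c ≡ b ⊕ c → a ≡ b
  bounded zero    {zero} {zero} _ _ = refl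
  bounded (suc f) {a} {b} {c} le eq with bitsView a | bitsView b | bitsView c
  ... | bits α a₁ | bits β b₁ | bits γ c₁ =
    cong₂ (λ p q → bit p + 2 * q)
          (xor-cancelʳ {α} {β} γ (proj₁ halves))
          (bounded f {a₁} {b₁} {c₁} (bit+2*-halves≤ α a₁ β b₁ le) (proj₂ halves))
    where
    halves : α xor γ ≡ β xor γ × a₁ ⊕ c₁ ≡ b₁ ⊕ c₁
    halves = bit+2*-injective _ _ _ _
      (trans (sym (⊕-bits α a₁ γ c₁)) (trans eq (⊕-bits β b₁ γ c₁)))

⊕-cancelˡ : ∀ a b c → a ⊕ b ≡ a ⊕ c → b ≡ c
⊕-cancelˡ a b c eq = ⊕-cancelʳ b c a (trans (⊕-comm b a) (trans eq (⊕-comm a c)))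

bit+2*-<-cases : ∀ {b c m n} → bit b + 2 * m < bit c + 2 * n →
                 m < n ⊎ (m ≡ n × b ≡ false × c ≡ true)
bit+2*-<-cases {b} {c} {m} {n} lt with <-cmp m n
... | tri< m<n _ _ = inj₁ m<n
... | tri> _ _ n<m = contradiction lt (<-asym (bit+2*-mono-< c b n<m))
bit+2*-<-cases {false} {true}  lt | tri≈ _ refl _ = inj₂ (refl , refl , refl)
bit+2*-<-cases {false} {false} lt | tri≈ _ refl _ = contradiction lt (<-irrefl refl)
bit+2*-<-cases {true}  {c}     lt | tri≈ _ refl _ =
  contradiction (bit≤1 c) (<⇒≱ (+-cancelʳ-< _ 1 (bit c) lt))

NimOption : ℕ → ℕ → ℕ → Set
NimOption a b m = (∃[ a′ ] a′ < a × a′ ⊕ b ≡ m) ⊎ (∃[ b′ ] b′ < b × a ⊕ b′ ≡ m)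

NimOption-bits : ∀ α β μ {a b m} → NimOption a b m →
                 NimOption (bit α + 2 * a) (bit β + 2 * b) (bit μ + 2 * m)
NimOption-bits α β μ {b = b} (inj₁ (a′ , a′<a , a′⊕b≡m)) =
  inj₁ (bit (μ xor β) + 2 * a′ , bit+2*-mono-< (μ xor β) α a′<a ,
        trans (⊕-bits (μ xor β) a′ β b) (cong₂ (λ p q → bit p + 2 * q) (xor-xorʳ μ β) a′⊕b≡m))
NimOption-bits α β μ {a = a} (inj₂ (b′ , b′<b , a⊕b′≡m)) =
  inj₂ (bit (α xor μ) + 2 * b′ , bit+2*-mono-< (α xor μ) β b′<b ,
        trans (⊕-bits α a (α xor μ) b′) (cong₂ (λ p q → bit p + 2 * q) (xor-xorˡ α μ) a⊕b′≡m))

NimOption-clearLowBit : ∀ α β a b → α xor β ≡ true →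
                        NimOption (bit α + 2 * a) (bit β + 2 * b) (bit false + 2 * (a ⊕ b))
NimOption-clearLowBit true  false a b _ = inj₁ (2 * a , ≤-refl , ⊕-bits false a false b)
NimOption-clearLowBit false true  a b _ = inj₂ (2 * b , ≤-refl , ⊕-bits false a false b)

<⊕⇒NimOption : ∀ a b {m} → m < a ⊕ b → NimOption a b m
<⊕⇒NimOption a b = bounded (a + b) ≤-refl
  where
  bounded : ∀ f {a b m} → a + b ≤ f → m < a ⊕ b → NimOption a b m
  bounded zero    {zero} {zero} _ ()
  bounded (suc f) {a} {b} {m} le lt with bitsView a | bitsView b | bitsView m
  ... | bits α a₁ | bits β b₁ | bits μ m₁
    with bit+2*-<-cases {μ} {α xor β} {m₁} {a₁ ⊕ b₁}
           (subst (bit μ + 2 * m₁ <_) (⊕-bits α a₁ β b₁) lt)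
  ... | inj₁ m₁<a₁⊕b₁ =
    NimOption-bits α β μ (bounded f {a₁} {b₁} {m₁} (bit+2*-halves≤ α a₁ β b₁ le) m₁<a₁⊕b₁)
  ... | inj₂ (refl , refl , α⊕β≡1) = NimOption-clearLowBit α β a₁ b₁ α⊕β≡1

OddPart : ℕ → ℕ → Set
OddPart N s = ∃[ k ] N ≡ 2 ^ k * (2 * s + 1)

2^0*[2s+1]≡1+2s : ∀ s → 2 ^ 0 * (2 * s + 1) ≡ 1 + 2 * s
2^0*[2s+1]≡1+2s s = trans (*-identityˡ (2 * s + 1)) (+-comm (2 * s) 1)

1+2s≢2n : ∀ s n → 1 + 2 * s ≢ 2 * n
1+2s≢2n s n eq with () ← proj₁ (bit+2*-injective true s false n eq)

n≤2^k*n : ∀ k n → n ≤ 2 ^ k * n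
n≤2^k*n k n = m≤n*m n (2 ^ k) {{m^n≢0 2 k}}

1≤2^k*odd : ∀ k s → 1 ≤ 2 ^ k * (2 * s + 1)
1≤2^k*odd k s = ≤-trans (m≤n+m 1 (2 * s)) (n≤2^k*n k (2 * s + 1))

odd≤OddPart : ∀ {N s} → OddPart N s → 2 * s + 1 ≤ N
odd≤OddPart {s = s} (k , N≡) = subst (2 * s + 1 ≤_) (sym N≡) (n≤2^k*n k (2 * s + 1))

∈G⇒OddPart : ∀ {x} s → x ∈G s → OddPart (suc x) s
∈G⇒OddPart s (k , x≡) = k , trans (cong suc x≡) (m+[n∸m]≡n (1≤2^k*odd k s))

OddPart⇒∈G : ∀ {x s} → OddPart (suc x) s → x ∈G s
OddPart⇒∈G (k , sx≡) = k , cong (_∸ 1) sx≡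

oddPart-exists : ∀ N → 1 ≤ N → ∃[ s ] OddPart N s
oddPart-exists = <-rec _ step
  where
  step : ∀ N → (∀ {h} → h < N → 1 ≤ h → ∃[ s ] OddPart h s) → 1 ≤ N → ∃[ s ] OddPart N s
  step N rec _ with bitsView N
  ... | bits true  h = h , 0 , sym (2^0*[2s+1]≡1+2s h)
  ... | bits false (suc h) with rec (n<2*n (s≤s z≤n)) (s≤s z≤n)
  ...   | s , k , h≡ = s , suc k , trans (cong (2 *_) h≡) (sym (*-assoc 2 (2 ^ k) (2 * s + 1)))

∈G-exists : ∀ x → ∃[ s ] x ∈G s
∈G-exists x with oddPart-exists (suc x) (s≤s z≤n)
... | s , sx-odd = s , OddPart⇒∈G {x} {s} sx-odd

2^k*odd-injective : ∀ j k {s t} → 2 ^ j * (2 * s + 1) ≡ 2 ^ k * (2 * t + 1) → s ≡ t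
2^k*odd-injective zero zero {s} {t} eq =
  *-cancelˡ-≡ s t 2 (suc-injective (trans (sym (2^0*[2s+1]≡1+2s s)) (trans eq (2^0*[2s+1]≡1+2s t))))
2^k*odd-injective zero (suc k) {s} {t} eq =
  contradiction (trans (sym (2^0*[2s+1]≡1+2s s)) (trans eq (*-assoc 2 (2 ^ k) (2 * t + 1))))
                (1+2s≢2n s (2 ^ k * (2 * t + 1)))
2^k*odd-injective (suc j) zero {s} {t} eq =
  contradiction (trans (sym (2^0*[2s+1]≡1+2s t)) (trans (sym eq) (*-assoc 2 (2 ^ j) (2 * s + 1))))
                (1+2s≢2n t (2 ^ j * (2 * s + 1)))
2^k*odd-injective (suc j) (suc k) {s} {t} eq = 2^k*odd-injective j k (*-cancelˡ-≡ _ _ 2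
  (trans (sym (*-assoc 2 (2 ^ j) (2 * s + 1))) (trans eq (*-assoc 2 (2 ^ k) (2 * t + 1)))))

oddPart-unique : ∀ {N s t} → OddPart N s → OddPart N t → s ≡ t
oddPart-unique (j , N≡) (k , N≡′) = 2^k*odd-injective j k (trans (sym N≡) N≡′)

2^j*n<2^k*n⇒2*2^j*n≤2^k*n : ∀ j k n → 2 ^ j * n < 2 ^ k * n → 2 * (2 ^ j * n) ≤ 2 ^ k * n
2^j*n<2^k*n⇒2*2^j*n≤2^k*n j k n lt with suc j ≤? k
... | yes j<k = subst (_≤ 2 ^ k * n) (*-assoc 2 (2 ^ j) n) (*-monoˡ-≤ n (^-monoʳ-≤ 2 j<k))
... | no  j≮k = contradiction lt (≤⇒≯ (*-monoˡ-≤ n (^-monoʳ-≤ 2 (≤-pred (≰⇒> j≮k)))))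

dyadic-bracket : ∀ {o} N → 1 ≤ o → o ≤ N → ∃[ k ] 2 ^ k * o ≤ N × N < 2 * (2 ^ k * o)
dyadic-bracket {o} = <-rec _ step
  where
  Bracket : ℕ → Set
  Bracket N = ∃[ k ] 2 ^ k * o ≤ N × N < 2 * (2 ^ k * o)
  step : ∀ N → (∀ {M} → M < N → 1 ≤ o → o ≤ M → Bracket M) → 1 ≤ o → o ≤ N → Bracket N
  step N rec 1≤o o≤N with N <? 2 * o
  ... | yes N<2o =
    0 , subst (_≤ N) (sym (*-identityˡ o)) o≤N , subst (λ p → N < 2 * p) (sym (*-identityˡ o)) N<2o
  ... | no  N≮2o with rec (n<2*m⇒⌊n/2⌋<m (n<2*n (≤-trans 1≤o o≤N))) 1≤o o≤⌊N/2⌋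
    where
    o≤⌊N/2⌋ : o ≤ ⌊ N /2⌋
    o≤⌊N/2⌋ = subst (_≤ ⌊ N /2⌋) (⌊bit+2*n/2⌋≡n false o) (⌊n/2⌋-mono (≮⇒≥ N≮2o))
  ... | k , lower , upper =
    suc k ,
    subst (_≤ N) (sym (*-assoc 2 (2 ^ k) o)) (≤-trans (*-monoʳ-≤ 2 lower) (2*⌊n/2⌋≤n N)) ,
    ⌊n/2⌋<m⇒n<2*m (subst (⌊ N /2⌋ <_) (sym (*-assoc 2 (2 ^ k) o)) upper)

Move : ℕ → ℕ → Set
Move x x′ = ⌈ x /2⌉ ≤ x′ × x′ < x

Move⇒sx<2*sx′ : ∀ {x x′} → Move x x′ → suc x < 2 * suc x′
Move⇒sx<2*sx′ (⌈x/2⌉≤x′ , _) = ⌊n/2⌋<m⇒n<2*m (s≤s ⌈x/2⌉≤x′)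

sx′<sx<2*sx′⇒Move : ∀ {x x′} → suc x′ < suc x → suc x < 2 * suc x′ → Move x x′
sx′<sx<2*sx′⇒Move sx′<sx sx<2sx′ = ≤-pred (n<2*m⇒⌊n/2⌋<m sx<2sx′) , ≤-pred sx′<sx

Move-leaves-G : ∀ {x x′} s → Move x x′ → x ∈G s → ¬ x′ ∈G s
Move-leaves-G {x} {x′} s mv@(_ , x′<x) x∈ x′∈
  with k , sx≡ ← ∈G⇒OddPart s x∈ | j , sx′≡ ← ∈G⇒OddPart s x′∈ =
  <-irrefl refl (<-≤-trans (Move⇒sx<2*sx′ mv) 2sx′≤sx)
  where
  2sx′≤sx : 2 * suc x′ ≤ suc x
  2sx′≤sx = subst₂ (λ p q → 2 * p ≤ q) (sym sx′≡) (sym sx≡)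
    (2^j*n<2^k*n⇒2*2^j*n≤2^k*n j k _ (subst₂ _<_ sx′≡ sx≡ (s≤s x′<x)))

Move-into-G : ∀ {x s m} → x ∈G s → m < s → ∃[ x′ ] Move x x′ × x′ ∈G m
Move-into-G {x} {s} {m} x∈ m<s
  with dyadic-bracket (suc x) (m≤n+m 1 (2 * m))
         (≤-trans (+-monoˡ-≤ 1 (*-monoʳ-≤ 2 (<⇒≤ m<s))) (odd≤OddPart {s = s} (∈G⇒OddPart s x∈)))
... | j , P≤sx , sx<2P =
  P ∸ 1 , sx′<sx<2*sx′⇒Move (subst (_< suc x) (sym sx′≡P) (≤∧≢⇒< P≤sx P≢sx))
                            (subst (λ p → suc x < 2 * p) (sym sx′≡P) sx<2P) ,
  (j , refl)
  where
  P : ℕ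
  P = 2 ^ j * (2 * m + 1)
  sx′≡P : suc (P ∸ 1) ≡ P
  sx′≡P = m+[n∸m]≡n (1≤2^k*odd j m)
  P≢sx : P ≢ suc x
  P≢sx P≡sx = <-irrefl (oddPart-unique (j , sym P≡sx) (∈G⇒OddPart s x∈)) m<s

contains-below⇒≤length : ∀ v (l : List ℕ) → (∀ m → m < v → m ∈ l) → v ≤ length l
contains-below⇒≤length zero    l _ = z≤n
contains-below⇒≤length (suc v) l below∈l with ys , zs , refl ← ∈-∃++ (below∈l v ≤-refl) =
  subst (suc v ≤_) (sym (trans (length-++ ys) (+-suc (length ys) (length zs))))
    (s≤s (subst (v ≤_) (length-++ ys) (contains-below⇒≤length v (ys ++ zs) below∈ys++zs)))
  where
  below∈ys++zs : ∀ m → m < v → m ∈ ys ++ zs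
  below∈ys++zs m m<v with ∈-++⁻ ys (below∈l m (m≤n⇒m≤1+n m<v))
  ... | inj₁ m∈ys          = ∈-++⁺ˡ m∈ys
  ... | inj₂ (here m≡v)    = contradiction m≡v (<⇒≢ m<v)
  ... | inj₂ (there m∈zs)  = ∈-++⁺ʳ ys m∈zs

mexAux≡ : ∀ k n l v → n ≤ v → v ≤ n + k → (∀ m → n ≤ m → m < v → m ∈ l) → v ∉ l →
          mexAux k n l ≡ v
mexAux≡ zero    n l v n≤v v≤n+0 _ _ = ≤-antisym n≤v (subst (v ≤_) (+-identityʳ n) v≤n+0)
mexAux≡ (suc k) n l v n≤v v≤n+k below∈l v∉l with n ∈? l
... | yes n∈l = mexAux≡ k (suc n) l v (≤∧≢⇒< n≤v λ n≡v → v∉l (subst (_∈ l) n≡v n∈l))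
                  (subst (v ≤_) (+-suc n k) v≤n+k) (λ m n<m → below∈l m (<⇒≤ n<m)) v∉l
... | no  n∉l with m≤n⇒m<n∨m≡n n≤v
...   | inj₁ n<v = contradiction (below∈l n ≤-refl n<v) n∉l
...   | inj₂ n≡v = n≡v

mex≡ : ∀ l v → (∀ m → m < v → m ∈ l) → v ∉ l → mex l ≡ v
mex≡ l v below∈l v∉l =
  mexAux≡ (length l) 0 l v z≤n (contains-below⇒≤length v l below∈l) (λ m _ → below∈l m) v∉l

enumFrom : ℕ → ℕ → List ℕ
enumFrom i zero    = []
enumFrom i (suc k) = i ∷ enumFrom (suc i) k

enumFrom-unique : ∀ {F : ℕ → ℕ → List ℕ} → (∀ i → F zero i ≡ []) →
                  (∀ k i → F (suc k) i ≡ i ∷ F k (suc i)) → ∀ k i → F k i ≡ enumFrom i k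
enumFrom-unique         F-zero F-suc zero    i = F-zero i
enumFrom-unique {F = F} F-zero F-suc (suc k) i =
  trans (F-suc k i) (cong (i ∷_) (enumFrom-unique {F = F} F-zero F-suc k (suc i)))

-- The local function go of range cannot be named here; the with-abstractions of b ∸ a and
-- suc a make its arguments variables, so that unification can solve F := go.
range≡enumFrom : ∀ a b → range a b ≡ enumFrom a (b ∸ a)
range≡enumFrom a b with enumFrom-unique (λ _ → refl) (λ _ _ → refl) | b ∸ a
... | _       | zero  = refl
... | go≡enum | suc k with suc a
...   | a⁺ = cong (a ∷_) (go≡enum k a⁺)

∈-enumFrom⁻ : ∀ {j} k i → j ∈ enumFrom i k → i ≤ j × j < i + k
∈-enumFrom⁻ (suc k) i (here refl) = ≤-refl , m<m+n i (s≤s z≤n)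
∈-enumFrom⁻ {j} (suc k) i (there j∈) with i<j , j<i+k ← ∈-enumFrom⁻ k (suc i) j∈ =
  <⇒≤ i<j , subst (j <_) (sym (+-suc i k)) j<i+k

∈-enumFrom⁺ : ∀ {j} k i → i ≤ j → j < i + k → j ∈ enumFrom i k
∈-enumFrom⁺ zero    i i≤j j<i+0 =
  contradiction (<-≤-trans j<i+0 (≤-reflexive (+-identityʳ i))) (≤⇒≯ i≤j)
∈-enumFrom⁺ {j} (suc k) i i≤j j<i+k with m≤n⇒m<n∨m≡n i≤j
... | inj₂ refl = here refl
... | inj₁ i<j  = there (∈-enumFrom⁺ k (suc i) i<j (subst (j <_) (+-suc i k) j<i+k))

∈-range⁻ : ∀ {a b j} → a ≤ b → j ∈ range a b → a ≤ j × j < b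
∈-range⁻ {a} {b} {j} a≤b j∈
  with a≤j , j<a+[b∸a] ← ∈-enumFrom⁻ (b ∸ a) a (subst (j ∈_) (range≡enumFrom a b) j∈) =
  a≤j , subst (j <_) (m+[n∸m]≡n a≤b) j<a+[b∸a]

∈-range⁺ : ∀ {a b j} → a ≤ j → j < b → j ∈ range a b
∈-range⁺ {a} {b} {j} a≤j j<b = subst (j ∈_) (sym (range≡enumFrom a b))
  (∈-enumFrom⁺ (b ∸ a) a a≤j (subst (j <_) (sym (m+[n∸m]≡n (<⇒≤ (≤-<-trans a≤j j<b)))) j<b))

grundyFuel≡⊕ : ∀ f x y s t → x + y < f → x ∈G s → y ∈G t → grundyFuel f x y ≡ s ⊕ t
grundyFuel≡⊕ (suc f) x y s t (s≤s x+y≤f) x∈ y∈ =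
  mex≡ options (s ⊕ t) below∈options ⊕∉options
  where
  gx : ℕ → ℕ
  gx x′ = grundyFuel f x′ y
  gy : ℕ → ℕ
  gy y′ = grundyFuel f x y′
  options : List ℕ
  options = map gx (range ⌈ x /2⌉ x) ++ map gy (range ⌈ y /2⌉ y)

  gx≡ : ∀ {x′} s′ → Move x x′ → x′ ∈G s′ → gx x′ ≡ s′ ⊕ t
  gx≡ {x′} s′ (_ , x′<x) x′∈ =
    grundyFuel≡⊕ f x′ y s′ t (<-≤-trans (+-monoˡ-< y x′<x) x+y≤f) x′∈ y∈
  gy≡ : ∀ {y′} t′ → Move y y′ → y′ ∈G t′ → gy y′ ≡ s ⊕ t′
  gy≡ {y′} t′ (_ , y′<y) y′∈ =
    grundyFuel≡⊕ f x y′ s t′ (<-≤-trans (+-monoʳ-< x y′<y) x+y≤f) x∈ y′∈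

  options-of-moves : ∀ {m} → m ∈ options →
                     (∃[ x′ ] Move x x′ × m ≡ gx x′) ⊎ (∃[ y′ ] Move y y′ × m ≡ gy y′)
  options-of-moves m∈ with ∈-++⁻ (map gx (range ⌈ x /2⌉ x)) m∈
  ... | inj₁ m∈x with x′ , x′∈ , m≡ ← ∈-map⁻ gx m∈x =
    inj₁ (x′ , ∈-range⁻ (⌈n/2⌉≤n x) x′∈ , m≡)
  ... | inj₂ m∈y with y′ , y′∈ , m≡ ← ∈-map⁻ gy m∈y =
    inj₂ (y′ , ∈-range⁻ (⌈n/2⌉≤n y) y′∈ , m≡)

  below∈options : ∀ m → m < s ⊕ t → m ∈ options
  below∈options m m<s⊕t with <⊕⇒NimOption s t m<s⊕t
  ... | inj₁ (s′ , s′<s , s′⊕t≡m)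
    with x′ , mv@(⌈x/2⌉≤x′ , x′<x) , x′∈ ← Move-into-G x∈ s′<s =
    subst (_∈ options) (trans (gx≡ s′ mv x′∈) s′⊕t≡m)
      (∈-++⁺ˡ (∈-map⁺ gx (∈-range⁺ ⌈x/2⌉≤x′ x′<x)))
  ... | inj₂ (t′ , t′<t , s⊕t′≡m)
    with y′ , mv@(⌈y/2⌉≤y′ , y′<y) , y′∈ ← Move-into-G y∈ t′<t =
    subst (_∈ options) (trans (gy≡ t′ mv y′∈) s⊕t′≡m)
      (∈-++⁺ʳ (map gx _) (∈-map⁺ gy (∈-range⁺ ⌈y/2⌉≤y′ y′<y)))

  ⊕∉options : s ⊕ t ∉ options
  ⊕∉options s⊕t∈ with options-of-moves s⊕t∈
  ... | inj₁ (x′ , mv , s⊕t≡) with s′ , x′∈ ← ∈G-exists x′ =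
    Move-leaves-G s mv x∈
      (subst (x′ ∈G_) (⊕-cancelʳ s′ s t (trans (sym (gx≡ s′ mv x′∈)) (sym s⊕t≡))) x′∈)
  ... | inj₂ (y′ , mv , s⊕t≡) with t′ , y′∈ ← ∈G-exists y′ =
    Move-leaves-G t mv y∈
      (subst (y′ ∈G_) (⊕-cancelˡ s t′ t (trans (sym (gy≡ t′ mv y′∈)) (sym s⊕t≡))) y′∈)

-- The formula also holds for the degenerate bars with x = 0 or y = 0.
theorem3p3 : (n x y : ℕ) → x ≥ 1 → y ≥ 1 →
    (𝒢 x y ≡ n) ⇔ (Σ ℕ λ s → Σ ℕ λ t → (s ⊕ t ≡ n) × (x ∈G s) × (y ∈G t))
theorem3p3 n x y _ _ = mk⇔ to from
  where
  𝒢≡⊕ : ∀ s t → x ∈G s → y ∈G t → 𝒢 x y ≡ s ⊕ t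
  𝒢≡⊕ s t = grundyFuel≡⊕ (suc (x + y)) x y s t ≤-refl

  to : 𝒢 x y ≡ n → Σ ℕ λ s → Σ ℕ λ t → (s ⊕ t ≡ n) × (x ∈G s) × (y ∈G t)
  to 𝒢≡n with s , x∈ ← ∈G-exists x | t , y∈ ← ∈G-exists y =
    s , t , trans (sym (𝒢≡⊕ s t x∈ y∈)) 𝒢≡n , x∈ , y∈

  from : (Σ ℕ λ s → Σ ℕ λ t → (s ⊕ t ≡ n) × (x ∈G s) × (y ∈G t)) → 𝒢 x y ≡ n
  from (s , t , s⊕t≡n , x∈ , y∈) = trans (𝒢≡⊕ s t x∈ y∈) s⊕t≡n
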